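{- Let $P$ be a graph property and $\sim=\sim_P$. Let $X_G$ be a branch bag in a rooted tree decomposition of a graph with a constant number $c$ of child bags $X_{H_1},\dots,X_{H_c}$, and let $H_i=\mathrm{tsg}(X_{H_i})$ for $i=1,\dots,c$. If $H_1',\dots,H_c'$ are terminal graphs with $H_i'\sim H_i$ and $X_{H_i'}=X_{H_i}$ for all $i$, then $$(H_1\oplus_T X_G)\oplus_{\rhd}\cdots\oplus_{\rhd}(H_c\oplus_T X_G)\ \sim\ (H_1'\oplus_T X_G)\oplus_{\rhd}\cdots\oplus_{\rhd}(H_c'\oplus_T X_G).$$
   Context: A terminal graph is $(V,E,X)$ with $X\subseteq V$ an ordered terminal set. $G\oplus H$ (equally many terminals) is the disjoint union with the $i$-th terminals identified (parallel edges merged). $G\sim_P H$ iff for all terminal graphs $K$, $P(G\oplus K)\Leftrightarrow P(H\oplus K)$. $H\oplus_T X=(V_H\cup X,E_H,X)$ for an ordered vertex set $X$. $A\oplus_{\rhd}B=(V_A\cup V_B,E_A\cup E_B,X_A)$ (ordinary union, parallel edges merged). A branch bag is the bag of a node with more than one child. For a bag $X_t$, $\mathrm{tsg}(X_t)$ is the subgraph induced by the vertices in $X_t$ and in all bags of descendants of $t$, with terminal set $X_t$ (in an arbitrary fixed order). -}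

module Defs where

open import Data.Nat using (ℕ; zero; suc; _+_; _*_; _<_; _≡ᵇ_)
open import Data.Bool using (if_then_else_)
open import Data.List using (List; []; _∷_; _++_; map; length; [_])
open import Data.List.Membership.Propositional using (_∈_; _∉_)
open import Data.List.Relation.Unary.Any using (Any)
open import Data.List.Relation.Unary.Unique.Propositional using (Unique)
open import Data.Maybe using (Maybe; just; nothing)
import Data.Maybe as Maybe
open import Data.Fin using (Fin)
open import Data.Product using (Σ; ∃; ∃-syntax; _×_; _,_)
open import Data.Sum using (_⊎_)
open import Data.Empty using (⊥)
open import Relation.Nullary using (¬_)
open import Relation.Binary.PropositionalEquality using (_≡_; _≢_)
open import Relation.Binary.Construct.Closure.ReflexiveTransitive using (Star)
open import Function.Bundles using (_⇔_)

-- Vertices are natural-number labels; the vertex set is the set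
-- of members of a finite list (duplicates are irrelevant); edges are a
-- relation (so parallel edges are automatically merged).

record Graph : Set₁ where
  constructor mkGraph
  field
    V : List ℕ
    E : ℕ → ℕ → Set

WFGraph : Graph → Set
WFGraph G =
  (∀ u v → E u v → u ∈ V × v ∈ V) ×
  (∀ u v → E u v → E v u) ×
  (∀ v → ¬ E v v)
  where open Graph G

record Iso (G H : Graph) : Set where
  private module G = Graph G
  private module H = Graph H
  field
    f g   : ℕ → ℕ
    f∈    : ∀ v → v ∈ G.V → f v ∈ H.V
    g∈    : ∀ w → w ∈ H.V → g w ∈ G.V
    gf    : ∀ v → v ∈ G.V → g (f v) ≡ v
    fg    : ∀ w → w ∈ H.V → f (g w) ≡ w
    edges : ∀ u v → u ∈ G.V → v ∈ G.V → (G.E u v ⇔ H.E (f u) (f v))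

record GraphProperty : Set₂ where
  field
    holds : Graph → Set
    iso-invariant : ∀ G H → Iso G H → holds G → holds H

record TGraph : Set₁ where
  constructor mkT
  field
    V : List ℕ
    E : ℕ → ℕ → Set
    X : List ℕ

underlying : TGraph → Graph
underlying H = mkGraph (TGraph.V H) (TGraph.E H)

WFT : TGraph → Set
WFT H = WFGraph (underlying H) × Unique X × (∀ v → v ∈ X → v ∈ V)
  where open TGraph H

idx : List ℕ → ℕ → Maybe ℕ
idx []       v = nothing
idx (x ∷ xs) v = if x ≡ᵇ v then just 0 else Maybe.map suc (idx xs v)

nthOr : List ℕ → ℕ → ℕ
nthOr []       _       = 0
nthOr (x ∷ xs) zero    = x
nthOr (x ∷ xs) (suc i) = nthOr xs i

-- G ⊕ K: disjoint union with the i-th terminals identified.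
renK : List ℕ → List ℕ → ℕ → ℕ
renK XG XK v with idx XK v
... | just i  = 2 * nthOr XG i
... | nothing = suc (2 * v)

_⊕_ : TGraph → TGraph → Graph
G ⊕ K = mkGraph (map (2 *_) (TGraph.V G) ++ map ρ (TGraph.V K)) E'
  where
  ρ = renK (TGraph.X G) (TGraph.X K)
  E' : ℕ → ℕ → Set
  E' a b = (∃[ u ] ∃[ v ] (a ≡ 2 * u × b ≡ 2 * v × TGraph.E G u v))
         ⊎ (∃[ u ] ∃[ v ] (a ≡ ρ u × b ≡ ρ v × TGraph.E K u v))

_∼[_]_ : TGraph → GraphProperty → TGraph → Set₁
G ∼[ P ] H = ∀ (K : TGraph) → WFT K →
  length (TGraph.X K) ≡ length (TGraph.X G) →
  length (TGraph.X K) ≡ length (TGraph.X H) →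
  (GraphProperty.holds P (G ⊕ K) ⇔ GraphProperty.holds P (H ⊕ K))

_⊕T_ : TGraph → List ℕ → TGraph
H ⊕T X = mkT (TGraph.V H ++ X) (TGraph.E H) X

_⊕▷_ : TGraph → TGraph → TGraph
A ⊕▷ B = mkT (TGraph.V A ++ TGraph.V B)
             (λ u v → TGraph.E A u v ⊎ TGraph.E B u v) (TGraph.X A)

-- A₁ ⊕▷ A₂ ⊕▷ ⋯ ⊕▷ Aₙ  (right-associated; ⊕▷ is associative anyway)
bigU : List TGraph → TGraph
bigU []           = mkT [] (λ _ _ → ⊥) []
bigU (A ∷ [])     = A
bigU (A ∷ B ∷ As) = A ⊕▷ bigU (B ∷ As)

data RTree : Set where
  node : List ℕ → List RTree → RTree

bag : RTree → List ℕ
bag (node X _) = X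

children : RTree → List RTree
children (node _ cs) = cs

mutual
  subAt : RTree → List ℕ → Maybe RTree
  subAt t          []      = just t
  subAt (node _ cs) (i ∷ p) = subIn cs i p

  subIn : List RTree → ℕ → List ℕ → Maybe RTree
  subIn []       _       _ = nothing
  subIn (t ∷ ts) zero    p = subAt t p
  subIn (t ∷ ts) (suc i) p = subIn ts i p

mutual
  allVerts : RTree → List ℕ
  allVerts (node X cs) = X ++ allVertsL cs

  allVertsL : List RTree → List ℕ
  allVertsL []       = []
  allVertsL (t ∷ ts) = allVerts t ++ allVertsL ts

Holds : RTree → ℕ → List ℕ → Set
Holds T v p = ∃[ t ] (subAt T p ≡ just t × v ∈ bag t)

TreeAdj : List ℕ → List ℕ → Set
TreeAdj p q = (∃[ i ] q ≡ p ++ [ i ]) ⊎ (∃[ i ] p ≡ q ++ [ i ])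

-- an edge of the subgraph of T induced by the nodes whose bag contains v
Step : RTree → ℕ → List ℕ → List ℕ → Set
Step T v p q = Holds T v p × Holds T v q × TreeAdj p q

record TreeDecomposition (Γ : Graph) (T : RTree) : Set where
  open Graph Γ
  field
    bags-set    : ∀ p t → subAt T p ≡ just t → Unique (bag t)
    bags-in-V   : ∀ p t → subAt T p ≡ just t → ∀ v → v ∈ bag t → v ∈ V
    vertex-cov  : ∀ v → v ∈ V → ∃[ p ] Holds T v p
    edge-cov    : ∀ u v → E u v →
                  ∃[ p ] ∃[ t ] (subAt T p ≡ just t × u ∈ bag t × v ∈ bag t)
    connected   : ∀ v p q → Holds T v p → Holds T v q → Star (Step T v) p q

tsg : Graph → RTree → TGraph
tsg Γ t = mkT (allVerts t)
              (λ u v → Graph.E Γ u v × u ∈ allVerts t × v ∈ allVerts t)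
              (bag t)

-- implicit freshness of the replacement graphs H'_i: their non-terminal
-- vertices are new (not in X_G and not shared with any other H'_j)
Fresh : List ℕ → {c : ℕ} → (Fin c → TGraph) → Set
Fresh XG {c} H' = ∀ i v → v ∈ TGraph.V (H' i) → v ∉ TGraph.X (H' i) →
  v ∉ XG × (∀ j → j ≢ i → v ∉ TGraph.V (H' j))

-- Both unions are gluings of their components along X_G, and ∼ is a congruence
-- for such gluings: if G arises from A and a rest R glued along X_A, and no inner
-- vertex of A occurs in R, then G ⊕ K ≅ A ⊕ C, where C is R ⊕ K with terminals X_A.
-- Hence replacing A by some A′ ∼ A does not affect P(G ⊕ K), and replacing the
-- children one at a time links the two unions. Each step needs the inner vertices
-- of the replaced component to avoid the rest: for tsg(X_{H_i}) this is the
-- separation property of tree decompositions, and the H′_i are first relabelled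
-- (which preserves ∼) so that their inner vertices lie above every vertex of Γ.

module Submission where

open import Defs
open import Level using (0ℓ)
open import Function using (_∘_; id)
open import Function.Bundles using (_⇔_; mk⇔; Equivalence)
open import Function.Properties.Equivalence using (⇔-setoid)
open import Data.Empty using (⊥-elim)
open import Data.Unit using (tt)
open import Data.Bool using (true; false; T)
open import Data.Product using (∃-syntax; _×_; _,_; proj₁; proj₂)
import Data.Product as Product
open import Data.Sum using (_⊎_; inj₁; inj₂)
import Data.Sum as Sum
open import Data.Sum.Function.Propositional using (_⊎-⇔_)
open import Data.Maybe using (just; nothing)
open import Data.Nat using (ℕ; zero; suc; _+_; _*_; _∸_; _≡ᵇ_; _<_; _≤_; z≤n; s≤s; ⌊_/2⌋; _≟_; _<?_)
open import Data.Nat.Properties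
  using (≡ᵇ⇒≡; ≡⇒≡ᵇ; +-suc; +-identityʳ; n≡⌊n+n/2⌋; *-cancelˡ-≡; even≢odd; suc-injective;
         <-cmp; <⇒≱; <⇒≤; m<n⇒m<1+n; ≤-reflexive; ≤-refl; +-cancelˡ-≡; m+n≮m; m+n∸m≡n)
open import Data.Fin using (Fin; zero; suc; toℕ; fromℕ<; punchIn; punchOut) renaming (_≟_ to _≟ᶠ_)
open import Data.Fin.Properties using (toℕ-injective; toℕ-fromℕ<; toℕ<n; punchInᵢ≢i; punchIn-punchOut)
open import Data.List using (List; []; _∷_; _++_; [_]; map; length; concat; tabulate; lookup)
open import Data.List.Properties using (length-map)
open import Data.List.Extrema.Nat using (max; xs≤max)
open import Data.List.Membership.Propositional using (_∈_; _∉_)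
open import Data.List.Membership.DecPropositional _≟_ using (_∈?_)
open import Data.List.Membership.Propositional.Properties
  using (∈-map⁺; ∈-map⁻; ∈-++⁺ˡ; ∈-++⁺ʳ; ∈-++⁻; ++-∈⇔; ∈-concat⁺; ∈-concat⁻)
open import Data.List.Relation.Unary.Any using (here; there)
import Data.List.Relation.Unary.Any.Properties as Any
open import Data.List.Relation.Unary.All using () renaming (lookup to All-lookup)
open import Data.List.Relation.Unary.AllPairs using (_∷_)
open import Data.List.Relation.Unary.Unique.Propositional using (Unique)
import Data.List.Relation.Unary.Unique.Propositional.Properties as Unique
open import Data.List.Relation.Binary.Prefix.Heterogeneous using (Prefix; []; _∷_; _++ᵖ_)
open import Data.List.Relation.Binary.Prefix.Heterogeneous.Properties using (prefix?)
open import Relation.Nullary using (¬_; yes; no)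
open import Relation.Unary using (Decidable)
open import Relation.Binary.Bundles using (Setoid)
open import Relation.Binary.Definitions using (tri<; tri≈; tri>)
open import Relation.Binary.Construct.Closure.ReflexiveTransitive using (Star; ε; _◅_)
open import Relation.Binary.PropositionalEquality
  using (_≡_; _≢_; refl; sym; trans; cong; subst; subst₂)

open TGraph

-- Labels in G ⊕ K

⌊2n/2⌋≡n : ∀ n → ⌊ 2 * n /2⌋ ≡ n
⌊2n/2⌋≡n n = sym (trans (n≡⌊n+n/2⌋ n) (cong (λ m → ⌊ n + m /2⌋) (sym (+-identityʳ n))))

⌊1+2n/2⌋≡n : ∀ n → ⌊ suc (2 * n) /2⌋ ≡ n
⌊1+2n/2⌋≡n zero    = refl
⌊1+2n/2⌋≡n (suc n) = cong suc (trans (cong ⌊_/2⌋ (+-suc n (n + 0))) (⌊1+2n/2⌋≡n n))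

2*-injective : ∀ {m n} → 2 * m ≡ 2 * n → m ≡ n
2*-injective {m} {n} = *-cancelˡ-≡ m n 2

∈-map-2*⁻ : ∀ {x L} → 2 * x ∈ map (2 *_) L → x ∈ L
∈-map-2*⁻ p with ∈-map⁻ (2 *_) p
... | y , y∈L , 2x≡2y = subst (_∈ _) (sym (2*-injective 2x≡2y)) y∈L

odd∉map-2* : ∀ w L → suc (2 * w) ∉ map (2 *_) L
odd∉map-2* w L p with ∈-map⁻ (2 *_) p
... | x , _ , eq = even≢odd x w (sym eq)

idx≡just⇒nthOr : ∀ L w {i} → idx L w ≡ just i → nthOr L i ≡ w × i < length L
idx≡just⇒nthOr []       w ()
idx≡just⇒nthOr (x ∷ xs) w eq with x ≡ᵇ w in x≡ᵇw
idx≡just⇒nthOr (x ∷ xs) w refl | true  = ≡ᵇ⇒≡ x w (subst T (sym x≡ᵇw) tt) , s≤s z≤n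
... | false with idx xs w in idx≡
idx≡just⇒nthOr (x ∷ xs) w refl | false | just j = Product.map₂ s≤s (idx≡just⇒nthOr xs w idx≡)

idx≡nothing⇒∉ : ∀ L w → idx L w ≡ nothing → w ∉ L
idx≡nothing⇒∉ []       w _  ()
idx≡nothing⇒∉ (x ∷ xs) w eq w∈ with x ≡ᵇ w in x≡ᵇw
idx≡nothing⇒∉ (x ∷ xs) w () w∈ | true
... | false with idx xs w in idx≡
idx≡nothing⇒∉ (x ∷ xs) w () w∈          | false | just _
idx≡nothing⇒∉ (x ∷ xs) w eq (here refl) | false | nothing = subst T x≡ᵇw (≡⇒≡ᵇ w w refl)
idx≡nothing⇒∉ (x ∷ xs) w eq (there w∈)  | false | nothing = idx≡nothing⇒∉ xs w idx≡ w∈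

nthOr-∈ : ∀ L {i} → i < length L → nthOr L i ∈ L
nthOr-∈ (x ∷ xs) {zero}  _       = here refl
nthOr-∈ (x ∷ xs) {suc i} (s≤s p) = there (nthOr-∈ xs p)

nthOr-map : ∀ f L {i} → i < length L → nthOr (map f L) i ≡ f (nthOr L i)
nthOr-map f (x ∷ xs) {zero}  _       = refl
nthOr-map f (x ∷ xs) {suc i} (s≤s p) = nthOr-map f xs p

nthOr-injective : ∀ L → Unique L → ∀ {i j} → i < length L → j < length L →
                  nthOr L i ≡ nthOr L j → i ≡ j
nthOr-injective (x ∷ xs) _        {zero}  {zero}  _       _       _  = refl
nthOr-injective (x ∷ xs) (x∉ ∷ _) {zero}  {suc j} _       (s≤s q) eq =
  ⊥-elim (All-lookup x∉ (nthOr-∈ xs q) eq)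
nthOr-injective (x ∷ xs) (x∉ ∷ _) {suc i} {zero}  (s≤s p) _       eq =
  ⊥-elim (All-lookup x∉ (nthOr-∈ xs p) (sym eq))
nthOr-injective (x ∷ xs) (_ ∷ u)  {suc i} {suc j} (s≤s p) (s≤s q) eq =
  cong suc (nthOr-injective xs u p q eq)

renK-cases : ∀ XG XK v →
  (∃[ i ] idx XK v ≡ just i × renK XG XK v ≡ 2 * nthOr XG i) ⊎
  (idx XK v ≡ nothing × renK XG XK v ≡ suc (2 * v))
renK-cases XG XK v with idx XK v in idx≡
... | just i  = inj₁ (i , refl , refl)
... | nothing = inj₂ (refl , refl)

module _ (XG XK : List ℕ) (len : length XK ≡ length XG) where

  renK-terminal-or-odd : ∀ w → (∃[ x ] x ∈ XG × renK XG XK w ≡ 2 * x) ⊎ renK XG XK w ≡ suc (2 * w)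
  renK-terminal-or-odd w with renK-cases XG XK w
  ... | inj₁ (i , idx≡ , ρw≡) =
    inj₁ (nthOr XG i , nthOr-∈ XG (subst (i <_) len (proj₂ (idx≡just⇒nthOr XK w idx≡))) , ρw≡)
  ... | inj₂ (_ , ρw≡) = inj₂ ρw≡

  renK-injective : Unique XG → ∀ u v → renK XG XK u ≡ renK XG XK v → u ≡ v
  renK-injective uXG u v eq with renK-cases XG XK u | renK-cases XG XK v
  ... | inj₁ (i , ei , ρu) | inj₁ (j , ej , ρv) =
    let xi≡u , i< = idx≡just⇒nthOr XK u ei
        xj≡v , j< = idx≡just⇒nthOr XK v ej
        i≡j = nthOr-injective XG uXG (subst (i <_) len i<) (subst (j <_) len j<)
                (2*-injective (trans (sym ρu) (trans eq ρv)))
    in trans (sym xi≡u) (trans (cong (nthOr XK) i≡j) xj≡v)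
  ... | inj₁ (i , _ , ρu) | inj₂ (_ , ρv) =
    ⊥-elim (even≢odd (nthOr XG i) v (trans (sym ρu) (trans eq ρv)))
  ... | inj₂ (_ , ρu) | inj₁ (j , _ , ρv) =
    ⊥-elim (even≢odd (nthOr XG j) u (trans (sym ρv) (trans (sym eq) ρu)))
  ... | inj₂ (_ , ρu) | inj₂ (_ , ρv) = 2*-injective (suc-injective (trans (sym ρu) (trans eq ρv)))

renK-map-2* : ∀ L w → (w ∈ map (2 *_) L × renK L (map (2 *_) L) w ≡ w)
                    ⊎ (w ∉ map (2 *_) L × renK L (map (2 *_) L) w ≡ suc (2 * w))
renK-map-2* L w with renK-cases L (map (2 *_) L) w
... | inj₁ (i , idx≡ , ρw≡) =
  let xi≡w , i< = idx≡just⇒nthOr (map (2 *_) L) w idx≡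
      i<L = subst (i <_) (length-map (2 *_) L) i<
  in inj₁ (subst (_∈ _) xi≡w (nthOr-∈ _ i<) ,
           trans ρw≡ (trans (sym (nthOr-map (2 *_) L i<L)) xi≡w))
... | inj₂ (idx≡ , ρw≡) = inj₂ (idx≡nothing⇒∉ _ w idx≡ , ρw≡)

-- Isomorphisms and the relation ∼

Iso-sym : ∀ {G H} → Iso G H → Iso H G
Iso-sym {H = H} i = record
  { f = g ; g = f ; f∈ = g∈ ; g∈ = f∈ ; gf = fg ; fg = gf
  ; edges = λ u v u∈ v∈ →
      let fg-u = fg u u∈ ; fg-v = fg v v∈
          e = edges (g u) (g v) (g∈ u u∈) (g∈ v v∈)
      in mk⇔ (λ x → Equivalence.from e (subst₂ (Graph.E H) (sym fg-u) (sym fg-v) x))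
             (λ x → subst₂ (Graph.E H) fg-u fg-v (Equivalence.to e x)) }
  where open Iso i

Iso-byLeftInverse : ∀ {G H} (f g : ℕ → ℕ) → (∀ a → g (f a) ≡ a) →
  (∀ a → a ∈ Graph.V G → f a ∈ Graph.V H) →
  (∀ b → b ∈ Graph.V H → ∃[ a ] a ∈ Graph.V G × b ≡ f a) →
  (∀ u v → Graph.E G u v ⇔ Graph.E H (f u) (f v)) → Iso G H
Iso-byLeftInverse f g gf f∈ onto edges = record
  { f = f ; g = g ; f∈ = f∈
  ; g∈ = λ b b∈ → let a , a∈ , b≡fa = onto b b∈ in subst (_∈ _) (sym (g-on b≡fa)) a∈
  ; gf = λ a _ → gf a
  ; fg = λ b b∈ → let a , _ , b≡fa = onto b b∈ in trans (cong f (g-on b≡fa)) (sym b≡fa)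
  ; edges = λ u v _ _ → edges u v }
  where
  g-on : ∀ {a b} → b ≡ f a → g b ≡ a
  g-on b≡fa = trans (cong g b≡fa) (gf _)

module ⇔ = Setoid (⇔-setoid 0ℓ)

module _ (P : GraphProperty) where
  open GraphProperty P

  Iso-holds⇔ : ∀ {G H} → Iso G H → holds G ⇔ holds H
  Iso-holds⇔ {G} {H} i = mk⇔ (iso-invariant G H i) (iso-invariant H G (Iso-sym i))

  ∼-refl : ∀ {G} → G ∼[ P ] G
  ∼-refl _ _ _ _ = ⇔.refl

  ∼-sym : ∀ {G H} → G ∼[ P ] H → H ∼[ P ] G
  ∼-sym G∼H K wfK lenH lenG = ⇔.sym (G∼H K wfK lenG lenH)

  ∼-trans : ∀ {G H I} → G ∼[ P ] H → H ∼[ P ] I → length (X H) ≡ length (X G) → G ∼[ P ] I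
  ∼-trans G∼H H∼I eq K wfK lenG lenI =
    let lenH = trans lenG (sym eq) in ⇔.trans (G∼H K wfK lenG lenH) (H∼I K wfK lenH lenI)

⊕-wellFormed : ∀ {G K} → WFT G → WFT K → length (X K) ≡ length (X G) → WFGraph (G ⊕ K)
⊕-wellFormed {G} {K} ((Gin , Gsym , Girr) , uXG , _) ((Kin , Ksym , Kirr) , _ , _) len =
  endpoints , symmetric , irreflexive
  where
  ρ : ℕ → ℕ
  ρ = renK (X G) (X K)
  endpoints : ∀ a b → Graph.E (G ⊕ K) a b → a ∈ Graph.V (G ⊕ K) × b ∈ Graph.V (G ⊕ K)
  endpoints _ _ (inj₁ (u , v , refl , refl , e)) =
    ∈-++⁺ˡ (∈-map⁺ (2 *_) (proj₁ (Gin u v e))) , ∈-++⁺ˡ (∈-map⁺ (2 *_) (proj₂ (Gin u v e)))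
  endpoints _ _ (inj₂ (u , v , refl , refl , e)) =
    ∈-++⁺ʳ _ (∈-map⁺ ρ (proj₁ (Kin u v e))) , ∈-++⁺ʳ _ (∈-map⁺ ρ (proj₂ (Kin u v e)))
  symmetric : ∀ a b → Graph.E (G ⊕ K) a b → Graph.E (G ⊕ K) b a
  symmetric _ _ (inj₁ (u , v , a≡ , b≡ , e)) = inj₁ (v , u , b≡ , a≡ , Gsym u v e)
  symmetric _ _ (inj₂ (u , v , a≡ , b≡ , e)) = inj₂ (v , u , b≡ , a≡ , Ksym u v e)
  irreflexive : ∀ a → ¬ Graph.E (G ⊕ K) a a
  irreflexive _ (inj₁ (u , v , a≡ , a≡′ , e)) with 2*-injective {u} {v} (trans (sym a≡) a≡′)
  ... | refl = Girr u e
  irreflexive _ (inj₂ (u , v , a≡ , a≡′ , e))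
    with renK-injective (X G) (X K) len uXG u v (trans (sym a≡) a≡′)
  ... | refl = Kirr u e

⊕T-wellFormed : ∀ {H L} → WFGraph (underlying H) → Unique L → WFT (H ⊕T L)
⊕T-wellFormed {H} (Hin , Hsym , Hirr) uL =
  ((λ u v e → Product.map ∈-++⁺ˡ ∈-++⁺ˡ (Hin u v e)) , Hsym , Hirr) , uL , λ v → ∈-++⁺ʳ (V H)

-- Replacing one part of a gluing

Inner : TGraph → ℕ → Set
Inner A v = v ∈ V A × v ∉ X A

withoutTerminals : Graph → TGraph
withoutTerminals Γ = mkT (Graph.V Γ) (Graph.E Γ) []

context : List ℕ → TGraph → TGraph → TGraph
context XA R K = withoutTerminals (R ⊕ K) ⊕T map (2 *_) XA

context-wellFormed : ∀ {XA R K} → Unique XA → WFT R → WFT K → length (X K) ≡ length (X R) →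
                     WFT (context XA R K)
context-wellFormed {R = R} {K} uXA wfR wfK len =
  ⊕T-wellFormed {withoutTerminals (R ⊕ K)} (⊕-wellFormed wfR wfK len) (Unique.map⁺ 2*-injective uXA)

record Decomposes (G A R : TGraph) : Set where
  field
    vertices    : ∀ v → v ∈ V G ⇔ (v ∈ V A ⊎ v ∈ V R)
    edges       : ∀ u v → E G u v ⇔ (E A u v ⊎ E R u v)
    terminals   : X R ≡ X G
    inner-fresh : ∀ v → Inner A v → v ∉ V R

module Reassociation {G A R K : TGraph} (D : Decomposes G A R)
  (wfA : WFT A) (wfR : WFT R) (wfK : WFT K) (len : length (X K) ≡ length (X G)) where

  open Decomposes D

  -- R with the terminals of G, so that R° ⊕ K renames K exactly as G ⊕ K does.
  R° : TGraph
  R° = mkT (V R) (E R) (X G)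

  C : TGraph
  C = context (X A) R° K

  ρ ρ′ : ℕ → ℕ
  ρ  = renK (X G) (X K)
  ρ′ = renK (X A) (map (2 *_) (X A))

  M : List ℕ
  M = map (2 *_) (V A)

  wfC : WFT C
  wfC = context-wellFormed (proj₁ (proj₂ wfA)) (subst (λ L → WFT (mkT (V R) (E R) L)) terminals wfR)
                           wfK len

  XA⊆A : ∀ x → x ∈ X A → x ∈ V A
  XA⊆A = proj₂ (proj₂ wfA)

  XG⊆R : ∀ x → x ∈ X G → x ∈ V R
  XG⊆R x x∈ = proj₂ (proj₂ wfR) x (subst (x ∈_) (sym terminals) x∈)

  2*∈C : ∀ {u} → u ∈ V R → 2 * u ∈ V C
  2*∈C u∈ = ∈-++⁺ˡ (∈-++⁺ˡ (∈-map⁺ (2 *_) u∈))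

  ρ∈C : ∀ {u} → u ∈ V K → ρ u ∈ V C
  ρ∈C u∈ = ∈-++⁺ˡ (∈-++⁺ʳ (map (2 *_) (V R)) (∈-map⁺ ρ u∈))

  M⊆G⊕K : ∀ {a} → a ∈ M → a ∈ Graph.V (G ⊕ K)
  M⊆G⊕K a∈M with ∈-map⁻ (2 *_) a∈M
  ... | u , u∈A , refl = ∈-++⁺ˡ (∈-map⁺ (2 *_) (Equivalence.from (vertices u) (inj₁ u∈A)))

  C⊆G⊕K : ∀ {w} → w ∈ V C → w ∈ Graph.V (G ⊕ K)
  C⊆G⊕K w∈C with ∈-++⁻ (Graph.V (R° ⊕ K)) w∈C
  ... | inj₂ w∈2XA with ∈-map⁻ (2 *_) w∈2XA
  ...   | x , x∈XA , refl = M⊆G⊕K (∈-map⁺ (2 *_) (XA⊆A x x∈XA))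
  C⊆G⊕K w∈C | inj₁ w∈R⊕K with ∈-++⁻ (map (2 *_) (V R)) w∈R⊕K
  ... | inj₂ w∈ρK = ∈-++⁺ʳ _ w∈ρK
  ... | inj₁ w∈2R with ∈-map⁻ (2 *_) w∈2R
  ...   | u , u∈R , refl = ∈-++⁺ˡ (∈-map⁺ (2 *_) (Equivalence.from (vertices u) (inj₂ u∈R)))

  G⊕K⊆M∪C : ∀ {a} → a ∈ Graph.V (G ⊕ K) → a ∈ M ⊎ a ∈ V C
  G⊕K⊆M∪C a∈ with ∈-++⁻ (map (2 *_) (V G)) a∈
  ... | inj₂ a∈ρK = inj₂ (∈-++⁺ˡ (∈-++⁺ʳ (map (2 *_) (V R)) a∈ρK))
  ... | inj₁ a∈2G with ∈-map⁻ (2 *_) a∈2G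
  ...   | u , u∈G , refl with Equivalence.to (vertices u) u∈G
  ...     | inj₁ u∈A = inj₁ (∈-map⁺ (2 *_) u∈A)
  ...     | inj₂ u∈R = inj₂ (2*∈C u∈R)

  2*inner∉C : ∀ {x} → Inner A x → 2 * x ∉ V C
  2*inner∉C {x} x-inner 2x∈C with ∈-++⁻ (Graph.V (R° ⊕ K)) 2x∈C
  ... | inj₂ 2x∈2XA = proj₂ x-inner (∈-map-2*⁻ 2x∈2XA)
  ... | inj₁ 2x∈R⊕K with ∈-++⁻ (map (2 *_) (V R)) 2x∈R⊕K
  ...   | inj₁ 2x∈2R = inner-fresh x x-inner (∈-map-2*⁻ 2x∈2R)
  ...   | inj₂ 2x∈ρK with ∈-map⁻ ρ 2x∈ρK
  ...     | u , _ , 2x≡ρu with renK-terminal-or-odd (X G) (X K) len u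
  ...       | inj₁ (z , z∈XG , ρu≡2z) =
    inner-fresh x x-inner (subst (_∈ V R) (2*-injective (trans (sym ρu≡2z) (sym 2x≡ρu))) (XG⊆R z z∈XG))
  ...       | inj₂ ρu≡odd = even≢odd x u (trans 2x≡ρu ρu≡odd)

  -- f keeps the copy M of A and sends every other label w to 2w + 1, which is
  -- where A ⊕ C puts an inner vertex w of C.
  f g : ℕ → ℕ
  f a with a ∈? M
  ... | yes _ = a
  ... | no  _ = suc (2 * a)
  g b with b ∈? M
  ... | yes _ = b
  ... | no  _ = ⌊ b /2⌋

  f-∈ : ∀ {a} → a ∈ M → f a ≡ a
  f-∈ {a} a∈M with a ∈? M
  ... | yes _  = refl
  ... | no a∉M = ⊥-elim (a∉M a∈M)

  f-∉ : ∀ {a} → a ∉ M → f a ≡ suc (2 * a)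
  f-∉ {a} a∉M with a ∈? M
  ... | yes a∈M = ⊥-elim (a∉M a∈M)
  ... | no _    = refl

  g∘f : ∀ a → g (f a) ≡ a
  g∘f a with a ∈? M
  ... | yes a∈M = g-∈
    where
    g-∈ : g a ≡ a
    g-∈ with a ∈? M
    ... | yes _  = refl
    ... | no a∉M = ⊥-elim (a∉M a∈M)
  ... | no _ = g-odd
    where
    g-odd : g (suc (2 * a)) ≡ a
    g-odd with suc (2 * a) ∈? M
    ... | yes odd∈M = ⊥-elim (odd∉map-2* a (V A) odd∈M)
    ... | no _      = ⌊1+2n/2⌋≡n a

  f-injective : ∀ {a b} → f a ≡ f b → a ≡ b
  f-injective {a} {b} fa≡fb = trans (sym (g∘f a)) (trans (cong g fa≡fb) (g∘f b))

  f≡ρ′ : ∀ {w} → w ∈ V C → f w ≡ ρ′ w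
  f≡ρ′ {w} w∈C with renK-map-2* (X A) w
  ... | inj₁ (w∈2XA , ρ′w≡w) with ∈-map⁻ (2 *_) w∈2XA
  ...   | x , x∈XA , refl = trans (f-∈ (∈-map⁺ (2 *_) (XA⊆A x x∈XA))) (sym ρ′w≡w)
  f≡ρ′ {w} w∈C | inj₂ (w∉2XA , ρ′w≡) = trans (f-∉ w∉M) (sym ρ′w≡)
    where
    w∉M : w ∉ M
    w∉M w∈M with ∈-map⁻ (2 *_) w∈M
    ... | x , x∈A , refl = 2*inner∉C (x∈A , λ x∈XA → w∉2XA (∈-map⁺ (2 *_) x∈XA)) w∈C

  f∈ : ∀ a → a ∈ Graph.V (G ⊕ K) → f a ∈ Graph.V (A ⊕ C)
  f∈ a a∈ with G⊕K⊆M∪C a∈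
  ... | inj₁ a∈M = subst (_∈ _) (sym (f-∈ a∈M)) (∈-++⁺ˡ a∈M)
  ... | inj₂ a∈C = subst (_∈ _) (sym (f≡ρ′ a∈C)) (∈-++⁺ʳ M (∈-map⁺ ρ′ a∈C))

  onto : ∀ b → b ∈ Graph.V (A ⊕ C) → ∃[ a ] a ∈ Graph.V (G ⊕ K) × b ≡ f a
  onto b b∈ with ∈-++⁻ M b∈
  ... | inj₁ b∈M = b , M⊆G⊕K b∈M , sym (f-∈ b∈M)
  ... | inj₂ b∈ρ′C with ∈-map⁻ ρ′ b∈ρ′C
  ...   | w , w∈C , refl = w , C⊆G⊕K w∈C , sym (f≡ρ′ w∈C)

  context-edge : ∀ {w w′} → E C w w′ → Graph.E (G ⊕ K) w w′
  context-edge (inj₁ (u , v , p , q , eR)) =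
    inj₁ (u , v , p , q , Equivalence.from (edges u v) (inj₂ eR))
  context-edge (inj₂ eK)                   = inj₂ eK

  edges-preserved : ∀ a b → Graph.E (G ⊕ K) a b ⇔ Graph.E (A ⊕ C) (f a) (f b)
  edges-preserved a b = mk⇔ forth back
    where
    A-endpoints : ∀ u v → E A u v → u ∈ V A × v ∈ V A
    A-endpoints = proj₁ (proj₁ wfA)
    R-endpoints : ∀ u v → E R u v → u ∈ V R × v ∈ V R
    R-endpoints = proj₁ (proj₁ wfR)
    K-endpoints : ∀ u v → E K u v → u ∈ V K × v ∈ V K
    K-endpoints = proj₁ (proj₁ wfK)
    C-endpoints : ∀ w w′ → E C w w′ → w ∈ V C × w′ ∈ V C
    C-endpoints = proj₁ (proj₁ wfC)

    forth : ∀ {a b} → Graph.E (G ⊕ K) a b → Graph.E (A ⊕ C) (f a) (f b)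
    forth (inj₁ (u , v , refl , refl , e)) with Equivalence.to (edges u v) e
    ... | inj₁ eA = let u∈ , v∈ = A-endpoints u v eA in
      inj₁ (u , v , f-∈ (∈-map⁺ (2 *_) u∈) , f-∈ (∈-map⁺ (2 *_) v∈) , eA)
    ... | inj₂ eR = let u∈ , v∈ = R-endpoints u v eR in
      inj₂ (2 * u , 2 * v , f≡ρ′ (2*∈C u∈) , f≡ρ′ (2*∈C v∈) , inj₁ (u , v , refl , refl , eR))
    forth (inj₂ (u , v , refl , refl , e)) = let u∈ , v∈ = K-endpoints u v e in
      inj₂ (ρ u , ρ v , f≡ρ′ (ρ∈C u∈) , f≡ρ′ (ρ∈C v∈) , inj₂ (u , v , refl , refl , e))

    back : ∀ {a b} → Graph.E (A ⊕ C) (f a) (f b) → Graph.E (G ⊕ K) a b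
    back (inj₁ (u , v , fa≡ , fb≡ , eA)) = let u∈ , v∈ = A-endpoints u v eA in
      inj₁ (u , v , f-injective (trans fa≡ (sym (f-∈ (∈-map⁺ (2 *_) u∈)))) ,
                    f-injective (trans fb≡ (sym (f-∈ (∈-map⁺ (2 *_) v∈)))) ,
                    Equivalence.from (edges u v) (inj₁ eA))
    back (inj₂ (w , w′ , fa≡ , fb≡ , eC)) = let w∈ , w′∈ = C-endpoints w w′ eC in
      subst₂ (Graph.E (G ⊕ K)) (f-injective (trans (f≡ρ′ w∈) (sym fa≡)))
             (f-injective (trans (f≡ρ′ w′∈) (sym fb≡))) (context-edge eC)

  iso : Iso (G ⊕ K) (A ⊕ C)
  iso = Iso-byLeftInverse f g g∘f f∈ onto edges-preserved

⊕-reassoc : ∀ {G A R K} → Decomposes G A R → WFT A → WFT R → WFT K →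
            length (X K) ≡ length (X G) → Iso (G ⊕ K) (A ⊕ context (X A) R K)
⊕-reassoc {G} {A} {R} {K} D wfA wfR wfK len =
  subst (λ L → Iso (G ⊕ K) (A ⊕ context (X A) (mkT (V R) (E R) L) K))
        (sym (Decomposes.terminals D)) (Reassociation.iso D wfA wfR wfK len)

module _ (P : GraphProperty) where
  open GraphProperty P
  open import Relation.Binary.Reasoning.Setoid (⇔-setoid 0ℓ)

  ∼-replace : ∀ {G G′ A A′ R} → Decomposes G A R → Decomposes G′ A′ R →
              WFT A → WFT A′ → WFT R → X A ≡ X A′ → A ∼[ P ] A′ → G ∼[ P ] G′
  ∼-replace {G} {G′} {A} {A′} {R} D D′ wfA wfA′ wfR XA≡XA′ A∼A′ K wfK lenG lenG′ =
    begin
      holds (G ⊕ K)    ≈⟨ Iso-holds⇔ P (⊕-reassoc D wfA wfR wfK lenG) ⟩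
      holds (A ⊕ C)    ≈⟨ A∼A′ C wfC lenA lenA′ ⟩
      holds (A′ ⊕ C)   ≈⟨ Iso-holds⇔ P (Iso-sym iso′) ⟩
      holds (G′ ⊕ K)   ∎
    where
    C : TGraph
    C = context (X A) R K
    wfC : WFT C
    wfC = context-wellFormed (proj₁ (proj₂ wfA)) wfR wfK
            (trans lenG (cong length (sym (Decomposes.terminals D))))
    lenA : length (X C) ≡ length (X A)
    lenA = length-map (2 *_) (X A)
    lenA′ : length (X C) ≡ length (X A′)
    lenA′ = trans lenA (cong length XA≡XA′)
    iso′ : Iso (G′ ⊕ K) (A′ ⊕ C)
    iso′ = subst (λ L → Iso (G′ ⊕ K) (A′ ⊕ context L R K)) (sym XA≡XA′)
                 (⊕-reassoc D′ wfA′ wfR wfK lenG′)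

-- Relabelling

relabel : (ℕ → ℕ) → TGraph → TGraph
relabel r G = mkT (map r (V G)) (λ a b → ∃[ u ] ∃[ v ] a ≡ r u × b ≡ r v × E G u v) (X G)

relabel-wellFormed : ∀ (r r′ : ℕ → ℕ) → (∀ u → r′ (r u) ≡ u) → ∀ {G} →
                     (∀ x → x ∈ X G → r x ≡ x) → WFT G → WFT (relabel r G)
relabel-wellFormed r r′ r′∘r {G} fixes ((Gin , Gsym , Girr) , uX , X⊆V) =
  (endpoints , symmetric , irreflexive) , uX , λ x x∈ → subst (_∈ _) (fixes x x∈) (∈-map⁺ r (X⊆V x x∈))
  where
  endpoints : ∀ a b → E (relabel r G) a b → a ∈ V (relabel r G) × b ∈ V (relabel r G)
  endpoints _ _ (u , v , refl , refl , e) = Product.map (∈-map⁺ r) (∈-map⁺ r) (Gin u v e)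
  symmetric : ∀ a b → E (relabel r G) a b → E (relabel r G) b a
  symmetric _ _ (u , v , a≡ , b≡ , e) = v , u , b≡ , a≡ , Gsym u v e
  irreflexive : ∀ a → ¬ E (relabel r G) a a
  irreflexive _ (u , v , a≡ , a≡′ , e)
    with trans (sym (r′∘r u)) (trans (cong r′ (trans (sym a≡) a≡′)) (r′∘r v))
  ... | refl = Girr u e

onDoubles : (ℕ → ℕ) → ℕ → ℕ
onDoubles r a with a ≟ 2 * ⌊ a /2⌋
... | yes _ = 2 * r ⌊ a /2⌋
... | no  _ = a

onDoubles-2* : ∀ r u → onDoubles r (2 * u) ≡ 2 * r u
onDoubles-2* r u with 2 * u ≟ 2 * ⌊ 2 * u /2⌋
... | yes _ = cong (λ x → 2 * r x) (⌊2n/2⌋≡n u)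
... | no ≢  = ⊥-elim (≢ (cong (2 *_) (sym (⌊2n/2⌋≡n u))))

onDoubles-odd : ∀ r u → onDoubles r (suc (2 * u)) ≡ suc (2 * u)
onDoubles-odd r u with suc (2 * u) ≟ 2 * ⌊ suc (2 * u) /2⌋
... | yes ≡ = ⊥-elim (even≢odd ⌊ suc (2 * u) /2⌋ u (sym ≡))
... | no _  = refl

onDoubles-inverse : ∀ {r r′} → (∀ u → r′ (r u) ≡ u) → ∀ a → onDoubles r′ (onDoubles r a) ≡ a
onDoubles-inverse {r} {r′} r′∘r a with a ≟ 2 * ⌊ a /2⌋
... | yes a≡ = trans (onDoubles-2* r′ (r ⌊ a /2⌋)) (trans (cong (2 *_) (r′∘r ⌊ a /2⌋)) (sym a≡))
... | no a≢  = fixed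
  where
  fixed : onDoubles r′ a ≡ a
  fixed with a ≟ 2 * ⌊ a /2⌋
  ... | yes a≡ = ⊥-elim (a≢ a≡)
  ... | no _   = refl

-- 2u ↦ 2 r u is an isomorphism G ⊕ K ≅ relabel r G ⊕ K: the only even labels of
-- vertices of K are the terminals 2x with x ∈ X G, and r fixes these.
module RelabelledGluing (r r′ : ℕ → ℕ) (r′∘r : ∀ u → r′ (r u) ≡ u) {G K : TGraph}
  (fixes : ∀ x → x ∈ X G → r x ≡ x) (len : length (X K) ≡ length (X G)) where

  ρ f : ℕ → ℕ
  ρ = renK (X G) (X K)
  f = onDoubles r

  f-injective : ∀ {a b} → f a ≡ f b → a ≡ b
  f-injective {a} {b} fa≡fb =
    trans (sym (onDoubles-inverse r′∘r a)) (trans (cong (onDoubles r′) fa≡fb) (onDoubles-inverse r′∘r b))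

  f∘ρ : ∀ w → f (ρ w) ≡ ρ w
  f∘ρ w with renK-terminal-or-odd (X G) (X K) len w
  ... | inj₁ (x , x∈ , ρw≡) =
    trans (cong f ρw≡) (trans (onDoubles-2* r x) (trans (cong (2 *_) (fixes x x∈)) (sym ρw≡)))
  ... | inj₂ ρw≡ = trans (cong f ρw≡) (trans (onDoubles-odd r w) (sym ρw≡))

  f∈ : ∀ a → a ∈ Graph.V (G ⊕ K) → f a ∈ Graph.V (relabel r G ⊕ K)
  f∈ a a∈ with ∈-++⁻ (map (2 *_) (V G)) a∈
  ... | inj₁ a∈2G with ∈-map⁻ (2 *_) a∈2G
  ...   | u , u∈ , refl = subst (_∈ _) (sym (onDoubles-2* r u)) (∈-++⁺ˡ (∈-map⁺ (2 *_) (∈-map⁺ r u∈)))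
  f∈ a a∈ | inj₂ a∈ρK with ∈-map⁻ ρ a∈ρK
  ...   | w , _ , refl = subst (_∈ _) (sym (f∘ρ w)) (∈-++⁺ʳ (map (2 *_) (map r (V G))) a∈ρK)

  onto : ∀ b → b ∈ Graph.V (relabel r G ⊕ K) → ∃[ a ] a ∈ Graph.V (G ⊕ K) × b ≡ f a
  onto b b∈ with ∈-++⁻ (map (2 *_) (map r (V G))) b∈
  ... | inj₁ b∈2rG with ∈-map⁻ (2 *_) b∈2rG
  ...   | y , y∈rG , refl with ∈-map⁻ r y∈rG
  ...     | u , u∈ , refl = 2 * u , ∈-++⁺ˡ (∈-map⁺ (2 *_) u∈) , sym (onDoubles-2* r u)
  onto b b∈ | inj₂ b∈ρK with ∈-map⁻ ρ b∈ρK
  ...   | w , w∈ , refl = ρ w , ∈-++⁺ʳ (map (2 *_) (V G)) (∈-map⁺ ρ w∈) , sym (f∘ρ w)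

  edges-preserved : ∀ a b → Graph.E (G ⊕ K) a b ⇔ Graph.E (relabel r G ⊕ K) (f a) (f b)
  edges-preserved a b = mk⇔ forth back
    where
    forth : ∀ {a b} → Graph.E (G ⊕ K) a b → Graph.E (relabel r G ⊕ K) (f a) (f b)
    forth (inj₁ (u , v , refl , refl , e)) =
      inj₁ (r u , r v , onDoubles-2* r u , onDoubles-2* r v , u , v , refl , refl , e)
    forth (inj₂ (u , v , refl , refl , e)) = inj₂ (u , v , f∘ρ u , f∘ρ v , e)

    back : ∀ {a b} → Graph.E (relabel r G ⊕ K) (f a) (f b) → Graph.E (G ⊕ K) a b
    back (inj₁ (_ , _ , fa≡ , fb≡ , u , v , refl , refl , e)) =
      inj₁ (u , v , f-injective (trans fa≡ (sym (onDoubles-2* r u))) ,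
                    f-injective (trans fb≡ (sym (onDoubles-2* r v))) , e)
    back (inj₂ (u , v , fa≡ , fb≡ , e)) =
      inj₂ (u , v , f-injective (trans fa≡ (sym (f∘ρ u))) , f-injective (trans fb≡ (sym (f∘ρ v))) , e)

  iso : Iso (G ⊕ K) (relabel r G ⊕ K)
  iso = Iso-byLeftInverse f (onDoubles r′) (onDoubles-inverse r′∘r) f∈ onto edges-preserved

relabel-∼ : ∀ P (r r′ : ℕ → ℕ) → (∀ u → r′ (r u) ≡ u) → ∀ {G} →
            (∀ x → x ∈ X G → r x ≡ x) → G ∼[ P ] relabel r G
relabel-∼ P r r′ r′∘r {G} fixes K _ len _ =
  Iso-holds⇔ P (RelabelledGluing.iso r r′ r′∘r {G} {K} fixes len)

-- Families glued along a common terminal list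

record IsGluing (XG : List ℕ) {n} (F : Fin n → TGraph) (G : TGraph) : Set where
  field
    vertices  : ∀ v → v ∈ V G ⇔ (v ∈ XG ⊎ ∃[ j ] v ∈ V (F j))
    edges     : ∀ u v → E G u v ⇔ (∃[ j ] E (F j) u v)
    terminals : X G ≡ XG

∃-cong : ∀ {n} {A B : Fin n → Set} → (∀ j → A j ≡ B j) → (∃[ j ] A j) ⇔ (∃[ j ] B j)
∃-cong A≡B = mk⇔ (Product.map₂ (λ {j} → subst id (A≡B j)))
                  (Product.map₂ (λ {j} → subst id (sym (A≡B j))))

IsGluing-cong : ∀ {XG n G} {F F′ : Fin n → TGraph} → (∀ j → F j ≡ F′ j) →
                IsGluing XG F G → IsGluing XG F′ G
IsGluing-cong F≡F′ gl = record
  { vertices  = λ v → ⇔.trans (vertices v) (⇔.refl ⊎-⇔ ∃-cong (λ j → cong (λ H → v ∈ V H) (F≡F′ j)))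
  ; edges     = λ u v → ⇔.trans (edges u v) (∃-cong (λ j → cong (λ H → E H u v) (F≡F′ j)))
  ; terminals = terminals }
  where open IsGluing gl

assemble : List ℕ → ∀ {n} → (Fin n → TGraph) → TGraph
assemble XG F = mkT (XG ++ concat (tabulate (V ∘ F))) (λ u v → ∃[ j ] E (F j) u v) XG

∈-concat-tabulate : ∀ {n v} (f : Fin n → List ℕ) → v ∈ concat (tabulate f) ⇔ (∃[ j ] v ∈ f j)
∈-concat-tabulate f =
  mk⇔ (λ v∈ → Any.tabulate⁻ (∈-concat⁻ (tabulate f) v∈)) (λ (j , v∈) → ∈-concat⁺ (Any.tabulate⁺ j v∈))

assemble-isGluing : ∀ XG {n} (F : Fin n → TGraph) → IsGluing XG F (assemble XG F)
assemble-isGluing XG F = record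
  { vertices  = λ v → ⇔.trans ++-∈⇔ (⇔.refl ⊎-⇔ ∈-concat-tabulate (V ∘ F))
  ; edges     = λ u v → ⇔.refl
  ; terminals = refl }

assemble-wellFormed : ∀ {XG n} {F : Fin n → TGraph} → Unique XG → (∀ j → WFT (F j)) →
                      WFT (assemble XG F)
assemble-wellFormed {XG} {F = F} uXG wf =
  (endpoints , symmetric , irreflexive) , uXG , λ v → ∈-++⁺ˡ
  where
  inV : ∀ {v} j → v ∈ V (F j) → v ∈ V (assemble XG F)
  inV j v∈ = ∈-++⁺ʳ XG (Equivalence.from (∈-concat-tabulate (V ∘ F)) (j , v∈))
  endpoints : ∀ u v → E (assemble XG F) u v → u ∈ V (assemble XG F) × v ∈ V (assemble XG F)
  endpoints u v (j , e) = Product.map (inV j) (inV j) (proj₁ (proj₁ (wf j)) u v e)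
  symmetric : ∀ u v → E (assemble XG F) u v → E (assemble XG F) v u
  symmetric u v (j , e) = j , proj₁ (proj₂ (proj₁ (wf j))) u v e
  irreflexive : ∀ v → ¬ E (assemble XG F) v v
  irreflexive v (j , e) = proj₂ (proj₂ (proj₁ (wf j))) v e

bigU-isGluing : ∀ XG {m} (F : Fin (suc m) → TGraph) → IsGluing XG F (bigU (tabulate (λ j → F j ⊕T XG)))
bigU-isGluing XG {zero} F = record
  { vertices  = λ v → mk⇔ (Sum.[ (λ v∈ → inj₂ (zero , v∈)) , inj₁ ]′ ∘ ∈-++⁻ (V (F zero)))
                          Sum.[ ∈-++⁺ʳ (V (F zero)) , (λ { (zero , v∈) → ∈-++⁺ˡ v∈ }) ]′
  ; edges     = λ u v → mk⇔ (zero ,_) (λ { (zero , e) → e })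
  ; terminals = refl }
bigU-isGluing XG {suc m} F = record
  { vertices  = λ v → mk⇔ to from
  ; edges     = λ u v → mk⇔ Sum.[ (zero ,_) , Product.map suc id ∘ Equivalence.to (rest.edges u v) ]′
                            (λ { (zero , e)  → inj₁ e
                               ; (suc i , e) → inj₂ (Equivalence.from (rest.edges u v) (i , e)) })
  ; terminals = refl }
  where
  Rest : TGraph
  Rest = bigU (tabulate (λ j → F (suc j) ⊕T XG))
  module rest = IsGluing (bigU-isGluing XG (F ∘ suc))

  to : ∀ {v} → v ∈ (V (F zero) ++ XG) ++ V Rest → v ∈ XG ⊎ ∃[ j ] v ∈ V (F j)
  to {v} v∈ with ∈-++⁻ (V (F zero) ++ XG) v∈
  ... | inj₁ v∈F₀∪XG = Sum.[ (λ v∈F₀ → inj₂ (zero , v∈F₀)) , inj₁ ]′ (∈-++⁻ (V (F zero)) v∈F₀∪XG)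
  ... | inj₂ v∈Rest  = Sum.map₂ (Product.map suc id) (Equivalence.to (rest.vertices v) v∈Rest)

  from : ∀ {v} → v ∈ XG ⊎ ∃[ j ] v ∈ V (F j) → v ∈ (V (F zero) ++ XG) ++ V Rest
  from (inj₁ v∈XG)          = ∈-++⁺ˡ (∈-++⁺ʳ (V (F zero)) v∈XG)
  from (inj₂ (zero , v∈F₀)) = ∈-++⁺ˡ (∈-++⁺ˡ v∈F₀)
  from {v} (inj₂ (suc i , v∈Fᵢ)) =
    ∈-++⁺ʳ (V (F zero) ++ XG) (Equivalence.from (rest.vertices v) (inj₂ (i , v∈Fᵢ)))

∃-punchIn⇔ : ∀ {m} (k : Fin (suc m)) (A : Fin (suc m) → Set) →
             (∃[ j ] A j) ⇔ (A k ⊎ ∃[ i ] A (punchIn k i))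
∃-punchIn⇔ k A = mk⇔ to Sum.[ (k ,_) , (λ (i , a) → punchIn k i , a) ]′
  where
  to : ∃[ j ] A j → A k ⊎ ∃[ i ] A (punchIn k i)
  to (j , a) with j ≟ᶠ k
  ... | yes refl = inj₁ a
  ... | no j≢k   = inj₂ (punchOut (j≢k ∘ sym) , subst A (sym (punchIn-punchOut (j≢k ∘ sym))) a)

gluing-decomposes : ∀ {XG m G} {F Q : Fin (suc m) → TGraph} (k : Fin (suc m)) → IsGluing XG F G →
  (∀ j → j ≢ k → F j ≡ Q j) → (∀ v → Inner (F k) v → v ∉ XG × (∀ j → j ≢ k → v ∉ V (Q j))) →
  Decomposes G (F k) (assemble XG (Q ∘ punchIn k))
gluing-decomposes {XG} {F = F} {Q} k gl F≡Q fresh = record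
  { vertices    = λ v → ⇔.trans (vertices v) (mk⇔ (to v) (from v))
  ; edges       = λ u v → ⇔.trans (edges u v) (⇔.trans (∃-punchIn⇔ k (λ j → E (F j) u v))
                    (⇔.refl ⊎-⇔ ∃-cong (λ i → cong (λ H → E H u v) (F≡Q′ i))))
  ; terminals   = sym terminals
  ; inner-fresh = inner-fresh }
  where
  open IsGluing gl
  R : TGraph
  R = assemble XG (Q ∘ punchIn k)
  module R = IsGluing (assemble-isGluing XG (Q ∘ punchIn k))

  F≡Q′ : ∀ i → F (punchIn k i) ≡ Q (punchIn k i)
  F≡Q′ i = F≡Q (punchIn k i) (punchInᵢ≢i k i)

  to : ∀ v → v ∈ XG ⊎ ∃[ j ] v ∈ V (F j) → v ∈ V (F k) ⊎ v ∈ V R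
  to v (inj₁ v∈XG)   = inj₂ (∈-++⁺ˡ v∈XG)
  to v (inj₂ v∈F) with Equivalence.to (∃-punchIn⇔ k (λ j → v ∈ V (F j))) v∈F
  ... | inj₁ v∈Fk      = inj₁ v∈Fk
  ... | inj₂ (i , v∈Fi) =
    inj₂ (Equivalence.from (R.vertices v) (inj₂ (i , subst (λ H → v ∈ V H) (F≡Q′ i) v∈Fi)))

  from : ∀ v → v ∈ V (F k) ⊎ v ∈ V R → v ∈ XG ⊎ ∃[ j ] v ∈ V (F j)
  from v (inj₁ v∈Fk) = inj₂ (k , v∈Fk)
  from v (inj₂ v∈R) with Equivalence.to (R.vertices v) v∈R
  ... | inj₁ v∈XG       = inj₁ v∈XG
  ... | inj₂ (i , v∈Qi) = inj₂ (punchIn k i , subst (λ H → v ∈ V H) (sym (F≡Q′ i)) v∈Qi)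

  inner-fresh : ∀ v → Inner (F k) v → v ∉ V R
  inner-fresh v inner v∈R with Equivalence.to (R.vertices v) v∈R
  ... | inj₁ v∈XG       = proj₁ (fresh v inner) v∈XG
  ... | inj₂ (i , v∈Qi) = proj₂ (fresh v inner) (punchIn k i) (punchInᵢ≢i k i) v∈Qi

∼-replace-component : ∀ P {XG m G G′} {F F′ : Fin (suc m) → TGraph} (k : Fin (suc m)) →
  Unique XG → IsGluing XG F G → IsGluing XG F′ G′ → (∀ j → j ≢ k → F j ≡ F′ j) →
  (∀ v → Inner (F k) v ⊎ Inner (F′ k) v → v ∉ XG × (∀ j → j ≢ k → v ∉ V (F j))) →
  (∀ j → WFT (F j)) → WFT (F′ k) → X (F k) ≡ X (F′ k) → F k ∼[ P ] F′ k → G ∼[ P ] G′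
∼-replace-component P k uXG gl gl′ F≡F′ fresh wf wf′k X≡ Fk∼F′k =
  ∼-replace P (gluing-decomposes k gl (λ _ _ → refl) (λ v → fresh v ∘ inj₁))
              (gluing-decomposes k gl′ (λ j j≢k → sym (F≡F′ j j≢k)) (λ v → fresh v ∘ inj₂))
              (wf k) wf′k (assemble-wellFormed uXG (wf ∘ punchIn k)) X≡ Fk∼F′k

Separated : List ℕ → ∀ {n} → (F F′ : Fin n → TGraph) → Set
Separated XG F F′ = ∀ j v → Inner (F j) v ⊎ Inner (F′ j) v →
  v ∉ XG × (∀ i → i ≢ j → v ∉ V (F i) × v ∉ V (F′ i))

module Hybrid (P : GraphProperty) {XG m} (F F′ : Fin (suc m) → TGraph) (uXG : Unique XG)
  (wf : ∀ j → WFT (F j)) (wf′ : ∀ j → WFT (F′ j)) (X≡ : ∀ j → X (F j) ≡ X (F′ j))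
  (sep : Separated XG F F′) (sim : ∀ j → F j ∼[ P ] F′ j) where

  mix : ℕ → Fin (suc m) → TGraph
  mix k j with toℕ j <? k
  ... | yes _ = F′ j
  ... | no  _ = F j

  mix-≥ : ∀ {k j} → k ≤ toℕ j → mix k j ≡ F j
  mix-≥ {k} {j} k≤j with toℕ j <? k
  ... | yes j<k = ⊥-elim (<⇒≱ j<k k≤j)
  ... | no  _   = refl

  mix-< : ∀ {k j} → toℕ j < k → mix k j ≡ F′ j
  mix-< {k} {j} j<k with toℕ j <? k
  ... | yes _   = refl
  ... | no  j≮k = ⊥-elim (j≮k j<k)

  mix-cases : ∀ k j → mix k j ≡ F j ⊎ mix k j ≡ F′ j
  mix-cases k j with toℕ j <? k
  ... | yes _ = inj₂ refl
  ... | no  _ = inj₁ refl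

  mix-step : ∀ {k j} → toℕ j ≢ k → mix (suc k) j ≡ mix k j
  mix-step {k} {j} j≢k with <-cmp (toℕ j) k
  ... | tri< j<k _ _ = trans (mix-< (m<n⇒m<1+n j<k)) (sym (mix-< j<k))
  ... | tri≈ _ j≡k _ = ⊥-elim (j≢k j≡k)
  ... | tri> _ _ k<j = trans (mix-≥ k<j) (sym (mix-≥ (<⇒≤ k<j)))

  wf-mix : ∀ k j → WFT (mix k j)
  wf-mix k j =
    Sum.[ (λ eq → subst WFT (sym eq) (wf j)) , (λ eq → subst WFT (sym eq) (wf′ j)) ]′ (mix-cases k j)

  X-mix : ∀ k j → X (mix k j) ≡ X (F j)
  X-mix k j = Sum.[ cong X , (λ eq → trans (cong X eq) (sym (X≡ j))) ]′ (mix-cases k j)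

  mix-fresh : ∀ k k′ j v → Inner (mix k j) v → v ∉ XG × (∀ i → i ≢ j → v ∉ V (mix k′ i))
  mix-fresh k k′ j v inner = proj₁ avoid , λ i i≢j → avoid-mix i (proj₂ avoid i i≢j)
    where
    avoid : v ∉ XG × (∀ i → i ≢ j → v ∉ V (F i) × v ∉ V (F′ i))
    avoid = sep j v (Sum.[ (λ eq → inj₁ (subst (λ H → Inner H v) eq inner))
                     , (λ eq → inj₂ (subst (λ H → Inner H v) eq inner)) ]′ (mix-cases k j))
    avoid-mix : ∀ i → v ∉ V (F i) × v ∉ V (F′ i) → v ∉ V (mix k′ i)
    avoid-mix i (∉F , ∉F′) with mix-cases k′ i
    ... | inj₁ eq = ∉F  ∘ subst (λ H → v ∈ V H) eq
    ... | inj₂ eq = ∉F′ ∘ subst (λ H → v ∈ V H) eq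

  replace-next : ∀ k (k<1+m : k < suc m) {G₂} → IsGluing XG (mix (suc k)) G₂ →
                 assemble XG (mix k) ∼[ P ] G₂
  replace-next k k<1+m gl₂ =
    ∼-replace-component P kᶠ uXG (assemble-isGluing XG (mix k)) gl₂
      (λ j j≢kᶠ → sym (mix-step (j≢kᶠ ∘ toℕ-injective ∘ λ j≡k → trans j≡k (sym toℕ-kᶠ))))
      (λ v → Sum.[ mix-fresh k k kᶠ v , mix-fresh (suc k) k kᶠ v ]′)
      (wf-mix k) (wf-mix (suc k) kᶠ) (trans (X-mix k kᶠ) (sym (X-mix (suc k) kᶠ)))
      (subst₂ (_∼[ P ]_) (sym (mix-≥ (≤-reflexive (sym toℕ-kᶠ))))
                         (sym (mix-< (s≤s (≤-reflexive toℕ-kᶠ))))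
              (sim kᶠ))
    where
    kᶠ : Fin (suc m)
    kᶠ = fromℕ< k<1+m
    toℕ-kᶠ : toℕ kᶠ ≡ k
    toℕ-kᶠ = toℕ-fromℕ< k<1+m

  chain : ∀ k → k ≤ suc m → ∀ {G₁ G₂} → IsGluing XG (mix 0) G₁ → IsGluing XG (mix k) G₂ → G₁ ∼[ P ] G₂
  -- Two gluings of the same family: replace component zero by itself.
  chain zero _ gl₁ gl₂ =
    ∼-replace-component P zero uXG gl₁ gl₂ (λ _ _ → refl)
      (λ v → Sum.[ mix-fresh 0 0 zero v , mix-fresh 0 0 zero v ]′)
      (wf-mix 0) (wf-mix 0 zero) refl (∼-refl P)
  chain (suc k) k<1+m gl₁ gl₂ =
    ∼-trans P (chain k (<⇒≤ k<1+m) gl₁ (assemble-isGluing XG (mix k))) (replace-next k k<1+m gl₂)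
              (cong length (sym (IsGluing.terminals gl₁)))

  ∼-gluing : ∀ {G G′} → IsGluing XG F G → IsGluing XG F′ G′ → G ∼[ P ] G′
  ∼-gluing gl gl′ = chain (suc m) ≤-refl (IsGluing-cong (λ _ → sym (mix-≥ z≤n)) gl)
                                          (IsGluing-cong (λ j → sym (mix-< (toℕ<n j))) gl′)

∼-bigU : ∀ P {XG m} (F F′ : Fin (suc m) → TGraph) → Unique XG →
  (∀ j → WFT (F j)) → (∀ j → WFT (F′ j)) → (∀ j → X (F j) ≡ X (F′ j)) →
  Separated XG F F′ → (∀ j → F j ∼[ P ] F′ j) →
  bigU (tabulate (λ j → F j ⊕T XG)) ∼[ P ] bigU (tabulate (λ j → F′ j ⊕T XG))
∼-bigU P {XG} F F′ uXG wf wf′ X≡ sep sim =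
  Hybrid.∼-gluing P F F′ uXG wf wf′ X≡ sep sim (bigU-isGluing XG F) (bigU-isGluing XG F′)

-- Tree decompositions

mutual
  subAt-++ : ∀ T a q {t t′} → subAt T a ≡ just t → subAt t q ≡ just t′ → subAt T (a ++ q) ≡ just t′
  subAt-++ T           []      q refl e′ = e′
  subAt-++ (node _ cs) (i ∷ a) q e    e′ = subIn-++ cs i a q e e′

  subIn-++ : ∀ cs i a q {t t′} → subIn cs i a ≡ just t → subAt t q ≡ just t′ →
             subIn cs i (a ++ q) ≡ just t′
  subIn-++ []       _       a q ()
  subIn-++ (c ∷ cs) zero    a q e e′ = subAt-++ c a q e e′
  subIn-++ (c ∷ cs) (suc i) a q e e′ = subIn-++ cs i a q e e′

subIn-lookup : ∀ cs (k : Fin (length cs)) → subIn cs (toℕ k) [] ≡ just (lookup cs k)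
subIn-lookup (c ∷ cs) zero    = refl
subIn-lookup (c ∷ cs) (suc k) = subIn-lookup cs k

mutual
  ∈allVerts⇒Holds : ∀ t {v} → v ∈ allVerts t → ∃[ q ] Holds t v q
  ∈allVerts⇒Holds (node B cs) v∈ with ∈-++⁻ B v∈
  ... | inj₁ v∈B  = [] , node B cs , refl , v∈B
  ... | inj₂ v∈cs = let i , q , holds = ∈allVertsL⇒Holds cs v∈cs in i ∷ q , holds

  -- node [] cs is the forest cs under a root with an empty bag.
  ∈allVertsL⇒Holds : ∀ cs {v} → v ∈ allVertsL cs → ∃[ i ] ∃[ q ] Holds (node [] cs) v (i ∷ q)
  ∈allVertsL⇒Holds (c ∷ cs) v∈ with ∈-++⁻ (allVerts c) v∈
  ... | inj₁ v∈c  = let q , holds = ∈allVerts⇒Holds c v∈c in 0 , q , holds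
  ... | inj₂ v∈cs = let i , q , holds = ∈allVertsL⇒Holds cs v∈cs in suc i , q , holds

bag⊆allVerts : ∀ t {v} → v ∈ bag t → v ∈ allVerts t
bag⊆allVerts (node B cs) = ∈-++⁺ˡ

Holds⇒∈bag : ∀ T a {t v} → subAt T a ≡ just t → Holds T v a → v ∈ bag t
Holds⇒∈bag T a at (t′ , at′ , v∈t′) with trans (sym at) at′
... | refl = v∈t′

Holds-++ : ∀ T a q {t v} → subAt T a ≡ just t → Holds t v q → Holds T v (a ++ q)
Holds-++ T a q at (t′ , at′ , v∈t′) = t′ , subAt-++ T a q at at′ , v∈t′

tsg-wellFormed : ∀ {Γ} → WFGraph Γ → ∀ t → Unique (bag t) → WFT (tsg Γ t)
tsg-wellFormed (_ , Γsym , Γirr) t uB =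
  ( (λ u v (_ , u∈ , v∈) → u∈ , v∈)
  , (λ u v (e , u∈ , v∈) → Γsym u v e , v∈ , u∈)
  , λ v (e , _) → Γirr v e ) ,
  uB , λ v → bag⊆allVerts t

_≼_ : List ℕ → List ℕ → Set
_≼_ = Prefix _≡_

Prefix-++ : ∀ a q → _≼_ a (a ++ q)
Prefix-++ []      q = []
Prefix-++ (x ∷ a) q = refl ∷ Prefix-++ a q

Prefix-∷ʳ⁻ : ∀ a b i → _≼_ a (b ++ [ i ]) → _≼_ a b ⊎ a ≡ b ++ [ i ]
Prefix-∷ʳ⁻ []          b       i _            = inj₁ []
Prefix-∷ʳ⁻ (x ∷ [])    []      i (refl ∷ [])  = inj₂ refl
Prefix-∷ʳ⁻ (x ∷ y ∷ a) []      i (refl ∷ ())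
Prefix-∷ʳ⁻ (x ∷ a)     (y ∷ b) i (refl ∷ a≼b) = Sum.map (refl ∷_) (cong (x ∷_)) (Prefix-∷ʳ⁻ a b i a≼b)

¬Prefix-∷ʳ : ∀ p k → ¬ _≼_ (p ++ [ k ]) p
¬Prefix-∷ʳ []      k ()
¬Prefix-∷ʳ (x ∷ p) k (_ ∷ r) = ¬Prefix-∷ʳ p k r

¬Prefix-sibling : ∀ p {j k} q → j ≢ k → ¬ _≼_ (p ++ [ k ]) ((p ++ [ j ]) ++ q)
¬Prefix-sibling []      q j≢k (k≡j ∷ _) = j≢k (sym k≡j)
¬Prefix-sibling (x ∷ p) q j≢k (_ ∷ r)   = ¬Prefix-sibling p q j≢k r

Prefix? : ∀ (a : List ℕ) → Decidable (_≼_ a)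
Prefix? = prefix? _≟_

Star-exit : ∀ {A : Set} {R : A → A → Set} {S : A → Set} → Decidable S → ∀ {x y} →
            Star R x y → S x → ¬ S y → ∃[ a ] ∃[ b ] R a b × S a × ¬ S b
Star-exit S? ε                   Sx ¬Sy = ⊥-elim (¬Sy Sx)
Star-exit S? (_◅_ {j = z} r rs) Sx ¬Sy with S? z
... | yes Sz = Star-exit S? rs Sz ¬Sy
... | no ¬Sz = _ , z , r , Sx , ¬Sz

bag-separates : ∀ {Γ T} → TreeDecomposition Γ T → ∀ a q {t v y} → subAt T a ≡ just t →
                Holds T v (a ++ q) → Holds T v y → ¬ _≼_ a y → v ∈ bag t
bag-separates TD a q {v = v} {y} at inside outside a⋠y
  with Star-exit (Prefix? a) (TreeDecomposition.connected TD v (a ++ q) y inside outside)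
                 (Prefix-++ a q) a⋠y
... | x , z , (_ , _ , inj₁ (i , refl)) , a≼x , a⋠z = ⊥-elim (a⋠z (a≼x ++ᵖ [ i ]))
... | x , z , (holds-x , _ , inj₂ (i , refl)) , a≼x , a⋠z =
  Sum.[ ⊥-elim ∘ a⋠z , (λ a≡x → Holds⇒∈bag _ a at (subst (Holds _ v) (sym a≡x) holds-x)) ]′
        (Prefix-∷ʳ⁻ a z i a≼x)

module BranchBag {Γ T} (TD : TreeDecomposition Γ T)
  (p : List ℕ) {XG cs} (at : subAt T p ≡ just (node XG cs)) where
  open TreeDecomposition TD

  child-at : ∀ k → subAt T (p ++ [ toℕ k ]) ≡ just (lookup cs k)
  child-at k = subAt-++ T p [ toℕ k ] at (subIn-lookup cs k)

  below-child : ∀ k {v} → v ∈ allVerts (lookup cs k) → ∃[ q ] Holds T v ((p ++ [ toℕ k ]) ++ q)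
  below-child k v∈ =
    let q , holds = ∈allVerts⇒Holds (lookup cs k) v∈ in q , Holds-++ T (p ++ [ toℕ k ]) q (child-at k) holds

  parent-unique : Unique XG
  parent-unique = bags-set p _ at

  parent⊆V : ∀ {v} → v ∈ XG → v ∈ Graph.V Γ
  parent⊆V = bags-in-V p _ at _

  child-unique : ∀ k → Unique (bag (lookup cs k))
  child-unique k = bags-set (p ++ [ toℕ k ]) _ (child-at k)

  allVerts⊆V : ∀ k {v} → v ∈ allVerts (lookup cs k) → v ∈ Graph.V Γ
  allVerts⊆V k v∈ =
    let q , t , at′ , v∈t = below-child k v∈ in bags-in-V ((p ++ [ toℕ k ]) ++ q) t at′ _ v∈t

  inner-∉parent : ∀ k {v} → Inner (tsg Γ (lookup cs k)) v → v ∉ XG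
  inner-∉parent k (v∈ , v∉bag) v∈XG =
    let q , inside = below-child k v∈ in
    v∉bag (bag-separates TD (p ++ [ toℕ k ]) q (child-at k) inside (_ , at , v∈XG)
                         (¬Prefix-∷ʳ p (toℕ k)))

  inner-∉sibling : ∀ k {v} → Inner (tsg Γ (lookup cs k)) v → ∀ j → j ≢ k → v ∉ allVerts (lookup cs j)
  inner-∉sibling k (v∈ , v∉bag) j j≢k v∈j =
    let q , inside = below-child k v∈
        q′ , outside = below-child j v∈j
    in v∉bag (bag-separates TD (p ++ [ toℕ k ]) q (child-at k) inside outside
                            (¬Prefix-sibling p q′ (j≢k ∘ toℕ-injective)))

-- Relabelling the replacement graphs

module RelabelledReplacements {Γ T} (TD : TreeDecomposition Γ T)
  (p : List ℕ) {XG cs} (at : subAt T p ≡ just (node XG cs))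
  (H′ : Fin (length cs) → TGraph) (wfH′ : ∀ j → WFT (H′ j))
  (XH′ : ∀ j → X (H′ j) ≡ bag (lookup cs j)) (fresh : Fresh XG H′) where

  open BranchBag TD p at

  H : Fin (length cs) → TGraph
  H j = tsg Γ (lookup cs j)

  B : Fin (length cs) → List ℕ
  B j = bag (lookup cs j)

  N : ℕ
  N = suc (max 0 (Graph.V Γ ++ concat (tabulate (V ∘ H′))))

  <N : ∀ {v} → v ∈ Graph.V Γ ++ concat (tabulate (V ∘ H′)) → v < N
  <N v∈ = s≤s (All-lookup (xs≤max 0 _) v∈)

  Γ<N : ∀ {v} → v ∈ Graph.V Γ → v < N
  Γ<N = <N ∘ ∈-++⁺ˡ

  H′<N : ∀ j {v} → v ∈ V (H′ j) → v < N
  H′<N j v∈ = <N (∈-++⁺ʳ (Graph.V Γ) (Equivalence.from (∈-concat-tabulate (V ∘ H′)) (j , v∈)))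

  B<N : ∀ j {v} → v ∈ B j → v < N
  B<N j = Γ<N ∘ allVerts⊆V j ∘ bag⊆allVerts (lookup cs j)

  shifted∉ : ∀ {u L} → (∀ {v} → v ∈ L → v < N) → N + u ∉ L
  shifted∉ {u} bound = m+n≮m N u ∘ bound

  shift unshift : Fin (length cs) → ℕ → ℕ
  shift j u with u ∈? B j
  ... | yes _ = u
  ... | no  _ = N + u
  unshift j w with w ∈? B j
  ... | yes _ = w
  ... | no  _ = w ∸ N

  shift-∈ : ∀ j {u} → u ∈ B j → shift j u ≡ u
  shift-∈ j {u} u∈ with u ∈? B j
  ... | yes _  = refl
  ... | no u∉ = ⊥-elim (u∉ u∈)

  unshift-∈ : ∀ j {w} → w ∈ B j → unshift j w ≡ w
  unshift-∈ j {w} w∈ with w ∈? B j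
  ... | yes _  = refl
  ... | no w∉ = ⊥-elim (w∉ w∈)

  unshift-shifted : ∀ j u → unshift j (N + u) ≡ u
  unshift-shifted j u with N + u ∈? B j
  ... | yes N+u∈ = ⊥-elim (shifted∉ (B<N j) N+u∈)
  ... | no _     = m+n∸m≡n N u

  unshift∘shift : ∀ j u → unshift j (shift j u) ≡ u
  unshift∘shift j u with u ∈? B j
  ... | yes u∈ = unshift-∈ j u∈
  ... | no _   = unshift-shifted j u

  shift-fixes : ∀ j x → x ∈ X (H′ j) → shift j x ≡ x
  shift-fixes j x x∈ = shift-∈ j (subst (x ∈_) (XH′ j) x∈)

  H″ : Fin (length cs) → TGraph
  H″ j = relabel (shift j) (H′ j)

  wfH″ : ∀ j → WFT (H″ j)
  wfH″ j = relabel-wellFormed (shift j) (unshift j) (unshift∘shift j) (shift-fixes j) (wfH′ j)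

  inner-fresh′ : ∀ j {v} → Inner (H′ j) v → v ∉ XG × (∀ i → i ≢ j → v ∉ V (H′ i))
  inner-fresh′ j (v∈ , v∉X) = fresh j _ v∈ v∉X

  ∈H″⁻ : ∀ j {v} → v ∈ V (H″ j) → v ∈ B j ⊎ ∃[ u ] Inner (H′ j) u × v ≡ N + u
  ∈H″⁻ j v∈ with ∈-map⁻ (shift j) v∈
  ... | u , u∈ , refl with u ∈? B j
  ...   | yes u∈B = inj₁ u∈B
  ...   | no u∉B  = inj₂ (u , (u∈ , u∉B ∘ subst (u ∈_) (XH′ j)) , refl)

  inner-H″⁻ : ∀ j {v} → Inner (H″ j) v → ∃[ u ] Inner (H′ j) u × v ≡ N + u
  inner-H″⁻ j (v∈ , v∉X) with ∈H″⁻ j v∈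
  ... | inj₁ v∈B = ⊥-elim (v∉X (subst (_ ∈_) (sym (XH′ j)) v∈B))
  ... | inj₂ shifted = shifted

  inner-H″-∉H″ : ∀ j {v} → Inner (H″ j) v → ∀ i → i ≢ j → v ∉ V (H″ i)
  inner-H″-∉H″ j inner i i≢j v∈ with inner-H″⁻ j inner
  ... | u , u-inner , refl with ∈H″⁻ i v∈
  ...   | inj₁ N+u∈B = shifted∉ (B<N i) N+u∈B
  ...   | inj₂ (u′ , (u′∈ , _) , N+u≡N+u′) with +-cancelˡ-≡ N u u′ N+u≡N+u′
  ...     | refl = proj₂ (inner-fresh′ j u-inner) i i≢j u′∈

  H-H″-separated : Separated XG H H″
  H-H″-separated j v (inj₁ inner) =
    inner-∉parent j inner , λ i i≢j → inner-∉sibling j inner i i≢j , ∉H″ i i≢j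
    where
    ∉H″ : ∀ i → i ≢ j → v ∉ V (H″ i)
    ∉H″ i i≢j v∈ with ∈H″⁻ i v∈
    ... | inj₁ v∈B = inner-∉sibling j inner i i≢j (bag⊆allVerts (lookup cs i) v∈B)
    ... | inj₂ (u , _ , refl) = shifted∉ Γ<N (allVerts⊆V j (proj₁ inner))
  H-H″-separated j v (inj₂ inner) with inner-H″⁻ j inner
  ... | u , _ , refl =
    shifted∉ (Γ<N ∘ parent⊆V) , λ i i≢j → shifted∉ (Γ<N ∘ allVerts⊆V i) , inner-H″-∉H″ j inner i i≢j

  H″-H′-separated : Separated XG H″ H′
  H″-H′-separated j v (inj₁ inner) with inner-H″⁻ j inner
  ... | u , _ , refl =
    shifted∉ (Γ<N ∘ parent⊆V) , λ i i≢j → inner-H″-∉H″ j inner i i≢j , shifted∉ (H′<N i)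
  H″-H′-separated j v (inj₂ inner) = proj₁ avoid , λ i i≢j → ∉H″ i i≢j , proj₂ avoid i i≢j
    where
    avoid : v ∉ XG × (∀ i → i ≢ j → v ∉ V (H′ i))
    avoid = inner-fresh′ j inner
    ∉H″ : ∀ i → i ≢ j → v ∉ V (H″ i)
    ∉H″ i i≢j v∈ with ∈H″⁻ i v∈
    ... | inj₁ v∈B = proj₂ avoid i i≢j (proj₂ (proj₂ (wfH′ i)) v (subst (v ∈_) (sym (XH′ i)) v∈B))
    ... | inj₂ (u , _ , refl) = shifted∉ (H′<N j) (proj₁ inner)

lemma3 : (P : GraphProperty) (Γ : Graph) → WFGraph Γ →
         (T : RTree) → TreeDecomposition Γ T →
         (p : List ℕ) (XG : List ℕ) (cs : List RTree) →
         subAt T p ≡ just (node XG cs) → 1 < length cs →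
         (H' : Fin (length cs) → TGraph) →
         (∀ i → WFT (H' i)) →
         (∀ i → H' i ∼[ P ] tsg Γ (lookup cs i)) →
         (∀ i → TGraph.X (H' i) ≡ TGraph.X (tsg Γ (lookup cs i))) →
         Fresh XG H' →
         bigU (tabulate (λ i → tsg Γ (lookup cs i) ⊕T XG))
           ∼[ P ]
         bigU (tabulate (λ i → H' i ⊕T XG))
lemma3 P Γ wfΓ T TD p XG []         at ()
lemma3 P Γ wfΓ T TD p XG cs@(_ ∷ _) at _ H′ wfH′ H′∼H XH′ fresh =
  ∼-trans P (∼-bigU P H H″ parent-unique wfH wfH″ (sym ∘ XH′) H-H″-separated H∼H″)
            (∼-bigU P H″ H′ parent-unique wfH″ wfH′ (λ _ → refl) H″-H′-separated H″∼H′)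
            (cong length (trans (bigU-terminals H″) (sym (bigU-terminals H))))
  where
  open BranchBag TD p at
  open RelabelledReplacements TD p at H′ wfH′ XH′ fresh

  bigU-terminals : ∀ F → X (bigU (tabulate (λ j → F j ⊕T XG))) ≡ XG
  bigU-terminals F = IsGluing.terminals (bigU-isGluing XG F)

  wfH : ∀ j → WFT (H j)
  wfH j = tsg-wellFormed wfΓ (lookup cs j) (child-unique j)

  H′∼H″ : ∀ j → H′ j ∼[ P ] H″ j
  H′∼H″ j = relabel-∼ P (shift j) (unshift j) (unshift∘shift j) (shift-fixes j)

  H∼H″ : ∀ j → H j ∼[ P ] H″ j
  H∼H″ j = ∼-trans P (∼-sym P (H′∼H j)) (H′∼H″ j) (cong length (XH′ j))

  H″∼H′ : ∀ j → H″ j ∼[ P ] H′ j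
  H″∼H′ j = ∼-sym P (H′∼H″ j)
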